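{- Let $\mathcal{G}$ be a temporal graph with $n$ vertices and lifetime $T$ such that each snapshot has at least one edge, let $\omega\ge 0$, and fix an integer $k\geq 2$. Then $$q^*_{k,\omega}(\mathcal{G})\geq \left(1-\frac{1}{k}\right) q^*_{\omega}(\mathcal{G}) + \frac{n\omega(T-1)}{2k\,\mu_\omega(\mathcal{G})},$$ where $\mu_\omega(\mathcal{G})=\frac12\omega n(T-1)+\sum_{t=1}^T m_t$.
   Context: A temporal graph $\mathcal{G}=(G,\lambda)$ with lifetime $T$ consists of a simple undirected graph $G=(V,E)$ with $n=|V|$ and $\lambda:E\to2^{[T]}$. Snapshots are $G_t=(V,E_t)$, $E_t=\{e\in E: t\in\lambda(e)\}$, $m_t=|E_t|$, with degrees $d_{v,t}$. For $A\subseteq V$, $e_{G_t}(A)$ is the number of edges of $G_t$ inside $A$ and $\mathrm{vol}_{G_t}(A)=\sum_{v\in A}d_{v,t}$. A partition $\mathcal{A}$ into $k$ parts is a function $\pi_{\mathcal{A}}:V\times[T]\to[k]$, inducing partitions $\mathcal{A}_t$ of $V$ for each $t$. The loyalty contribution is $\mathcal{L}(\mathcal{A})=\sum_{v\in V}\sum_{t=1}^{T-1}\mathbf{1}[\pi_{\mathcal{A}}(v,t)=\pi_{\mathcal{A}}(v,t+1)]$. The temporal modularity is $q_\omega(\mathcal{G},\mathcal{A})=\frac{1}{2\mu_\omega(\mathcal{G})}\left(\sum_{t=1}^T\sum_{A\in\mathcal{A}_t}\left(2e_{G_t}(A)-\frac{\mathrm{vol}_{G_t}(A)^2}{2m_t}\right)+\omega\mathcal{L}(\mathcal{A})\right)$.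 $q^*_\omega(\mathcal{G})$ is the maximum of $q_\omega(\mathcal{G},\mathcal{A})$ over all partitions (any number of parts), and $q^*_{k,\omega}(\mathcal{G})$ the maximum over partitions with at most $k$ parts.
   Formalization: The parameter ω ranges over the nonnegative rationals. -}

module Defs where

open import Data.Nat as ℕ using (ℕ; zero; suc; _∸_; _<_)
open import Data.Fin using (Fin; toℕ; zero; suc)
open import Data.Fin.Properties using () renaming (_≟_ to _≟ᶠ_)
open import Data.Bool using (Bool; true; false; if_then_else_)
open import Data.Integer using (+_)
open import Data.Rational using (ℚ; 0ℚ; 1ℚ; _+_; _*_; _-_; _÷_; _/_; ≢-nonZero)
open import Data.Rational.Properties using (_≟_)
open import Relation.Nullary using (yes; no; Dec; does)
open import Relation.Binary.PropositionalEquality using (_≡_)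

ℕ→ℚ : ℕ → ℚ
ℕ→ℚ n = + n / 1

𝟙 : {P : Set} → Dec P → ℚ
𝟙 d = if does d then 1ℚ else 0ℚ

∑ : (n : ℕ) → (Fin n → ℚ) → ℚ
∑ zero    f = 0ℚ
∑ (suc n) f = f zero + ∑ n (λ i → f (suc i))

-- division on ℚ, made total by p / 0 := 0 (only ever used with a
-- provably nonzero denominator in the statement)
_÷'_ : ℚ → ℚ → ℚ
p ÷' q with q ≟ 0ℚ
... | yes _  = 0ℚ
... | no q≢0 = _÷_ p q {{≢-nonZero q≢0}}

-- Temporal graphs on vertex set Fin n with lifetime T.
-- Snapshot t ∈ [T] is represented by Fin T (t = 1..T ↦ 0..T-1).
-- adj t u v = true  iff  {u,v} ∈ E_t, i.e. {u,v} ∈ E and t ∈ λ({u,v}).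

record TemporalGraph (n T : ℕ) : Set where
  field
    adj       : Fin T → Fin n → Fin n → Bool
    adj-sym   : ∀ t u v → adj t u v ≡ adj t v u
    adj-irrefl : ∀ t u → adj t u u ≡ false
open TemporalGraph public

b→ℚ : Bool → ℚ
b→ℚ true  = 1ℚ
b→ℚ false = 0ℚ

module _ {n T : ℕ} (𝒢 : TemporalGraph n T) where

  -- e_{G_t}(A) for A given by membership predicate inA (edges counted once:
  -- unordered pairs u < v)
  eIn : Fin T → (Fin n → Bool) → ℚ
  eIn t inA = ∑ n λ u → ∑ n λ v →
    𝟙 (toℕ u ℕ.<? toℕ v) * (b→ℚ (inA u) * (b→ℚ (inA v) * b→ℚ (adj 𝒢 t u v)))

  m : Fin T → ℚ
  m t = eIn t (λ _ → true)

  deg : Fin n → Fin T → ℚ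
  deg u t = ∑ n λ v → b→ℚ (adj 𝒢 t u v)

  vol : Fin T → (Fin n → Bool) → ℚ
  vol t inA = ∑ n λ u → b→ℚ (inA u) * deg u t

  μ : ℚ → ℚ
  μ ω = (1ℚ ÷' ℕ→ℚ 2) * ω * ℕ→ℚ n * ℕ→ℚ (T ∸ 1) + ∑ T m

  -- A partition with (at most) K parts: π : V × [T] → [K]
  Partition : ℕ → Set
  Partition K = Fin n → Fin T → Fin K

  part : {K : ℕ} → Partition K → Fin T → Fin K → Fin n → Bool
  part π t c v = does (π v t ≟ᶠ c)

  loyalty : {K : ℕ} → Partition K → ℚ
  loyalty π = ∑ n λ v → ∑ T λ s → ∑ T λ t →
    𝟙 (toℕ t ℕ.≟ suc (toℕ s)) * 𝟙 (π v s ≟ᶠ π v t)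

  -- Σ_t Σ_{A ∈ 𝒜_t} (2 e(A) - vol(A)² / (2 m_t)); labels with empty class
  -- contribute 0, so summing over all labels c ∈ [K] is the same.
  snapshotTerm : {K : ℕ} → Partition K → ℚ
  snapshotTerm {K} π = ∑ T λ t → ∑ K λ c →
    (ℕ→ℚ 2 * eIn t (part π t c)
      - (vol t (part π t c) * vol t (part π t c)) ÷' (ℕ→ℚ 2 * m t))

  q : ℚ → {K : ℕ} → Partition K → ℚ
  q ω π = (snapshotTerm π + ω * loyalty π) ÷' (ℕ→ℚ 2 * μ ω)

-- Coarsening π by a labelling f of its K classes, the numerator of q_ω is
-- Σ_{c,c′} [f c = f c′] W c c′ for one fixed K × K matrix W (the contributions of the
-- vertex-time pairs whose π-classes are c and c′). The identity labelling recovers π,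
-- so trace W is the numerator of π; a constant labelling gives the one-class partition,
-- whose snapshot terms vanish and whose loyalty is n (T - 1), so total W = n ω (T - 1).
-- A uniformly random labelling into k classes has expected within-class weight
-- trace W + (total W - trace W) / k, and some labelling attains at least that;
-- dividing by 2 μ_ω gives the bound.

module Submission where

open import Defs
open import Data.Nat as ℕ using (ℕ; zero; suc; _≤_; _∸_)
import Data.Nat.Properties as ℕP
open import Data.Fin using (Fin; zero; suc; toℕ; inject₁)
import Data.Fin.Properties as FinP
open import Data.Fin.Properties using () renaming (_≟_ to _≟ᶠ_)
open import Data.Vec.Functional using (_∷_)
import Data.Integer as ℤ
import Data.Integer.Properties as ℤP
open import Data.Nat.Coprimality using (1-coprimeTo) renaming (sym to coprime-sym)
open import Data.Rational
  using (ℚ; 0ℚ; 1ℚ; _+_; _*_; _-_; _<_; 1/_; positive; nonNegative; ≢-nonZero)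
  renaming (_≤_ to _≤ℚ_)
import Data.Rational.Properties as QP
open import Data.Rational.Solver using (module +-*-Solver)
open +-*-Solver
open import Data.Product using (∃; _,_; proj₁; proj₂)
open import Data.Sum using (inj₁; inj₂)
open import Data.Empty using (⊥-elim)
open import Data.Unit using (tt)
open import Relation.Nullary using (Dec; yes; no; ¬_; does)
open import Relation.Nullary.Decidable using (toWitness)
open import Relation.Binary.Definitions using (Tri; tri<; tri≈; tri>)
open import Relation.Binary.PropositionalEquality

ℕ→ℚ-suc : ∀ n → ℕ→ℚ (suc n) ≡ 1ℚ + ℕ→ℚ n
ℕ→ℚ-suc n = sym (trans (cong (1ℚ +_) (QP.normalize-coprime (coprime-sym (1-coprimeTo n))))
  (QP./-cong {p₁ = ℤ.+ 1 ℤ.* ℤ.+ 1 ℤ.+ ℤ.+ n ℤ.* ℤ.+ 1} {q₁ = 1 ℕ.* 1}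
    (cong (λ z → ℤ.+ 1 ℤ.+ z) (ℤP.*-identityʳ (ℤ.+ n))) refl))

ℕ→ℚ-nonNeg : ∀ n → 0ℚ ≤ℚ ℕ→ℚ n
ℕ→ℚ-nonNeg n = QP.nonNegative⁻¹ _ {{QP.normalize-nonNeg n 1}}

ℕ→ℚ-pos : ∀ n → 0ℚ < ℕ→ℚ (suc n)
ℕ→ℚ-pos n = QP.positive⁻¹ _ {{QP.normalize-pos (suc n) 1}}

2*x≡x+x : ∀ x → ℕ→ℚ 2 * x ≡ x + x
2*x≡x+x = solve 1 (λ x → (con 1ℚ :+ con 1ℚ) :* x := x :+ x) refl

*-pos : ∀ {a b} → 0ℚ < a → 0ℚ < b → 0ℚ < a * b
*-pos {a} {b} 0<a 0<b =
  QP.positive⁻¹ (a * b) {{QP.pos*pos⇒pos a {{positive 0<a}} b {{positive 0<b}}}}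

*-nonNeg : ∀ {a b} → 0ℚ ≤ℚ a → 0ℚ ≤ℚ b → 0ℚ ≤ℚ a * b
*-nonNeg {a} {b} 0≤a 0≤b =
  QP.nonNegative⁻¹ (a * b) {{QP.nonNeg*nonNeg⇒nonNeg a {{nonNegative 0≤a}} b {{nonNegative 0≤b}}}}

pos⇒≢0 : ∀ {x} → 0ℚ < x → x ≢ 0ℚ
pos⇒≢0 0<x x≡0 = QP.<-irrefl (sym x≡0) 0<x

recip : ℚ → ℚ
recip y = 1ℚ ÷' y

÷'≡*recip : ∀ x y → x ÷' y ≡ x * recip y
÷'≡*recip x y with y QP.≟ 0ℚ
... | yes _ = sym (QP.*-zeroʳ x)
... | no _  = cong (x *_) (sym (QP.*-identityˡ _))

*-recip : ∀ {y} → y ≢ 0ℚ → y * recip y ≡ 1ℚ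
*-recip {y} y≢0 with y QP.≟ 0ℚ
... | yes y≡0 = ⊥-elim (y≢0 y≡0)
... | no y≢0′ = trans (cong (y *_) (QP.*-identityˡ _)) (QP.*-inverseʳ y {{≢-nonZero y≢0′}})

recip-pos : ∀ {y} → 0ℚ < y → 0ℚ < recip y
recip-pos {y} 0<y with y QP.≟ 0ℚ
... | yes y≡0 = ⊥-elim (pos⇒≢0 0<y y≡0)
... | no y≢0  = subst (0ℚ <_) (sym (QP.*-identityˡ 1/y)) (QP.positive⁻¹ 1/y {{QP.1/pos⇒pos y {{positive 0<y}}}})
  where 1/y = (1/ y) {{≢-nonZero y≢0}}

recip-unique : ∀ {x y} → x ≢ 0ℚ → x * y ≡ 1ℚ → recip x ≡ y
recip-unique {x} {y} x≢0 xy≡1 = begin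
  recip x             ≡⟨ sym (QP.*-identityʳ _) ⟩
  recip x * 1ℚ        ≡⟨ cong (recip x *_) (sym xy≡1) ⟩
  recip x * (x * y)   ≡⟨ solve 3 (λ r x y → r :* (x :* y) := (x :* r) :* y) refl (recip x) x y ⟩
  (x * recip x) * y   ≡⟨ cong (_* y) (*-recip x≢0) ⟩
  1ℚ * y              ≡⟨ QP.*-identityˡ y ⟩
  y                   ∎
  where open ≡-Reasoning

recip-* : ∀ {a b} → 0ℚ < a → 0ℚ < b → recip (a * b) ≡ recip a * recip b
recip-* {a} {b} 0<a 0<b = recip-unique (pos⇒≢0 (*-pos 0<a 0<b)) (begin
  (a * b) * (recip a * recip b)   ≡⟨ solve 4 (λ a b r s → (a :* b) :* (r :* s) := (a :* r) :* (b :* s))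
                                       refl a b (recip a) (recip b) ⟩
  (a * recip a) * (b * recip b)   ≡⟨ cong₂ _*_ (*-recip (pos⇒≢0 0<a)) (*-recip (pos⇒≢0 0<b)) ⟩
  1ℚ * 1ℚ                         ≡⟨ QP.*-identityˡ 1ℚ ⟩
  1ℚ                              ∎)
  where open ≡-Reasoning

-- Both sides are 1/(κ a μ) times the two sides of the hypothesis.
÷'-rescale : ∀ {a κ μ D S F} → 0ℚ < a → 0ℚ < κ → 0ℚ < μ →
  (κ - 1ℚ) * D + S ≤ℚ κ * F →
  (1ℚ - recip κ) * (D ÷' (a * μ)) + S ÷' (a * κ * μ) ≤ℚ F ÷' (a * μ)
÷'-rescale {a} {κ} {μ} {D} {S} {F} 0<a 0<κ 0<μ hyp = begin
  (1ℚ - i) * (D ÷' (a * μ)) + S ÷' (a * κ * μ)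
    ≡⟨ cong₂ (λ x y → (1ℚ - i) * x + y) (÷'≡*recip D (a * μ))
         (trans (÷'≡*recip S (a * κ * μ)) (cong (S *_) recip-aκμ)) ⟩
  (1ℚ - i) * (D * j) + S * (i * j)
    ≡⟨ solve 5 (λ i j κ D S → (con 1ℚ :- i) :* (D :* j) :+ S :* (i :* j)
                 := (i :* j) :* ((κ :- con 1ℚ) :* D :+ S) :+ (con 1ℚ :- κ :* i) :* (D :* j))
         refl i j κ D S ⟩
  (i * j) * ((κ - 1ℚ) * D + S) + (1ℚ - κ * i) * (D * j)
    ≡⟨ cong (λ z → (i * j) * ((κ - 1ℚ) * D + S) + (1ℚ - z) * (D * j)) κi≡1 ⟩
  (i * j) * ((κ - 1ℚ) * D + S) + (1ℚ - 1ℚ) * (D * j)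
    ≡⟨ solve 2 (λ x y → x :+ (con 1ℚ :- con 1ℚ) :* y := x) refl _ (D * j) ⟩
  (i * j) * ((κ - 1ℚ) * D + S)
    ≤⟨ QP.*-monoˡ-≤-nonNeg (i * j) {{nonNegative (QP.<⇒≤ (*-pos (recip-pos 0<κ) (recip-pos 0<aμ)))}} hyp ⟩
  (i * j) * (κ * F)
    ≡⟨ solve 4 (λ i j κ F → (i :* j) :* (κ :* F) := (κ :* i) :* (F :* j)) refl i j κ F ⟩
  (κ * i) * (F * j)
    ≡⟨ trans (cong (_* (F * j)) κi≡1) (QP.*-identityˡ (F * j)) ⟩
  F * j
    ≡⟨ sym (÷'≡*recip F (a * μ)) ⟩
  F ÷' (a * μ) ∎
  where
  open QP.≤-Reasoning
  i : ℚ
  i = recip κ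
  j : ℚ
  j = recip (a * μ)
  0<aμ : 0ℚ < a * μ
  0<aμ = *-pos 0<a 0<μ
  κi≡1 : κ * i ≡ 1ℚ
  κi≡1 = *-recip (pos⇒≢0 0<κ)
  recip-aκμ : recip (a * κ * μ) ≡ i * j
  recip-aκμ = trans (cong recip (solve 3 (λ a κ μ → a :* κ :* μ := κ :* (a :* μ)) refl a κ μ))
                    (recip-* 0<κ 0<aμ)

𝟙-yes : {P : Set} (d : Dec P) → P → 𝟙 d ≡ 1ℚ
𝟙-yes (yes _) _ = refl
𝟙-yes (no ¬p) p = ⊥-elim (¬p p)

𝟙-no : {P : Set} (d : Dec P) → ¬ P → 𝟙 d ≡ 0ℚ
𝟙-no (yes p) ¬p = ⊥-elim (¬p p)
𝟙-no (no _)  _  = refl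

𝟙-cong : {P Q : Set} (d : Dec P) (e : Dec Q) → (P → Q) → (Q → P) → 𝟙 d ≡ 𝟙 e
𝟙-cong (yes p) e P→Q _   = sym (𝟙-yes e (P→Q p))
𝟙-cong (no ¬p) e _   Q→P = sym (𝟙-no e (λ q → ¬p (Q→P q)))

b→ℚ-does : {P : Set} (d : Dec P) → b→ℚ (does d) ≡ 𝟙 d
b→ℚ-does (yes _) = refl
b→ℚ-does (no _)  = refl

𝟙-≟-sym : ∀ {k} (a b : Fin k) → 𝟙 (a ≟ᶠ b) ≡ 𝟙 (b ≟ᶠ a)
𝟙-≟-sym a b = 𝟙-cong (a ≟ᶠ b) (b ≟ᶠ a) sym sym

∑-cong : ∀ n {f g : Fin n → ℚ} → (∀ i → f i ≡ g i) → ∑ n f ≡ ∑ n g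
∑-cong zero    f≗g = refl
∑-cong (suc n) f≗g = cong₂ _+_ (f≗g zero) (∑-cong n (λ i → f≗g (suc i)))

∑-zero : ∀ n → ∑ n (λ _ → 0ℚ) ≡ 0ℚ
∑-zero zero    = refl
∑-zero (suc n) = trans (cong (0ℚ +_) (∑-zero n)) (QP.+-identityˡ 0ℚ)

∑-distrib-+ : ∀ n (f g : Fin n → ℚ) → ∑ n (λ i → f i + g i) ≡ ∑ n f + ∑ n g
∑-distrib-+ zero    f g = sym (QP.+-identityˡ 0ℚ)
∑-distrib-+ (suc n) f g =
  trans (cong (f zero + g zero +_) (∑-distrib-+ n (λ i → f (suc i)) (λ i → g (suc i))))
        (solve 4 (λ a b c d → (a :+ b) :+ (c :+ d) := (a :+ c) :+ (b :+ d)) refl (f zero) (g zero) _ _)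

*-distribˡ-∑ : ∀ n a (f : Fin n → ℚ) → ∑ n (λ i → a * f i) ≡ a * ∑ n f
*-distribˡ-∑ zero    a f = sym (QP.*-zeroʳ a)
*-distribˡ-∑ (suc n) a f = trans (cong (a * f zero +_) (*-distribˡ-∑ n a (λ i → f (suc i))))
                                 (sym (QP.*-distribˡ-+ a (f zero) _))

*-distribʳ-∑ : ∀ n a (f : Fin n → ℚ) → ∑ n (λ i → f i * a) ≡ ∑ n f * a
*-distribʳ-∑ n a f = trans (∑-cong n (λ i → QP.*-comm (f i) a))
                           (trans (*-distribˡ-∑ n a f) (QP.*-comm a _))

∑-linear : ∀ n α β (X Z : Fin n → ℚ) → ∑ n (λ i → α * X i - Z i * β) ≡ α * ∑ n X - ∑ n Z * β
∑-linear zero    α β X Z = solve 2 (λ α β → con 0ℚ := α :* con 0ℚ :- con 0ℚ :* β) refl α β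
∑-linear (suc n) α β X Z =
  trans (cong (α * X zero - Z zero * β +_) (∑-linear n α β (λ i → X (suc i)) (λ i → Z (suc i))))
        (solve 6 (λ α β x z sx sz → (α :* x :- z :* β) :+ (α :* sx :- sz :* β)
                                    := α :* (x :+ sx) :- (z :+ sz) :* β) refl α β (X zero) (Z zero) _ _)

∑∑-linear : ∀ n α β (X Z : Fin n → Fin n → ℚ) →
  ∑ n (λ u → ∑ n λ v → α * X u v - Z u v * β)
    ≡ α * ∑ n (λ u → ∑ n (X u)) - ∑ n (λ u → ∑ n (Z u)) * β
∑∑-linear n α β X Z = trans (∑-cong n (λ u → ∑-linear n α β (X u) (Z u))) (∑-linear n α β _ _)

∑-comm : ∀ n m (f : Fin n → Fin m → ℚ) →
  ∑ n (λ i → ∑ m (λ j → f i j)) ≡ ∑ m (λ j → ∑ n (λ i → f i j))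
∑-comm zero    m f = sym (∑-zero m)
∑-comm (suc n) m f = trans (cong (∑ m (f zero) +_) (∑-comm n m (λ i → f (suc i))))
                           (sym (∑-distrib-+ m (f zero) (λ j → ∑ n (λ i → f (suc i) j))))

∑-𝟙-≟ : ∀ n (x : Fin n) (g : Fin n → ℚ) → ∑ n (λ c → 𝟙 (x ≟ᶠ c) * g c) ≡ g x
∑-𝟙-≟ (suc n) zero g = begin
  𝟙 (zero {n} ≟ᶠ zero) * g zero + ∑ n (λ c → 𝟙 (zero ≟ᶠ suc c) * g (suc c))
    ≡⟨ cong₂ _+_ (cong (_* g zero) (𝟙-yes (zero {n} ≟ᶠ zero) refl))
                 (∑-cong n (λ c → cong (_* g (suc c)) (𝟙-no (zero ≟ᶠ suc c) (λ ())))) ⟩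
  1ℚ * g zero + ∑ n (λ c → 0ℚ * g (suc c))
    ≡⟨ cong (1ℚ * g zero +_) (trans (∑-cong n (λ c → QP.*-zeroˡ (g (suc c)))) (∑-zero n)) ⟩
  1ℚ * g zero + 0ℚ
    ≡⟨ solve 1 (λ a → con 1ℚ :* a :+ con 0ℚ := a) refl (g zero) ⟩
  g zero ∎
  where open ≡-Reasoning
∑-𝟙-≟ (suc n) (suc x) g = begin
  𝟙 (suc x ≟ᶠ zero) * g zero + ∑ n (λ c → 𝟙 (suc x ≟ᶠ suc c) * g (suc c))
    ≡⟨ cong₂ _+_ (trans (cong (_* g zero) (𝟙-no (suc x ≟ᶠ zero) (λ ()))) (QP.*-zeroˡ (g zero)))
                 (∑-cong n (λ c → cong (_* g (suc c))
                   (𝟙-cong (suc x ≟ᶠ suc c) (x ≟ᶠ c) FinP.suc-injective (cong suc)))) ⟩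
  0ℚ + ∑ n (λ c → 𝟙 (x ≟ᶠ c) * g (suc c))
    ≡⟨ QP.+-identityˡ _ ⟩
  ∑ n (λ c → 𝟙 (x ≟ᶠ c) * g (suc c))
    ≡⟨ ∑-𝟙-≟ n x (λ c → g (suc c)) ⟩
  g (suc x) ∎
  where open ≡-Reasoning

∑-fibres : ∀ {K k} (g : Fin K → Fin k) (a : Fin K → ℚ) →
  ∑ k (λ y → ∑ K (λ c → 𝟙 (y ≟ᶠ g c) * a c)) ≡ ∑ K a
∑-fibres {K} {k} g a = trans (∑-comm k K _) (∑-cong K (λ c →
  trans (∑-cong k (λ y → cong (_* a c) (𝟙-≟-sym y (g c)))) (∑-𝟙-≟ k (g c) (λ _ → a c))))

∑-const : ∀ n a → ∑ n (λ _ → a) ≡ ℕ→ℚ n * a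
∑-const zero    a = sym (QP.*-zeroˡ a)
∑-const (suc n) a = begin
  a + ∑ n (λ _ → a)  ≡⟨ cong (a +_) (∑-const n a) ⟩
  a + ℕ→ℚ n * a      ≡⟨ solve 2 (λ a x → a :+ x :* a := (con 1ℚ :+ x) :* a) refl a (ℕ→ℚ n) ⟩
  (1ℚ + ℕ→ℚ n) * a   ≡⟨ cong (_* a) (sym (ℕ→ℚ-suc n)) ⟩
  ℕ→ℚ (suc n) * a    ∎
  where open ≡-Reasoning

∑-mono-≤ : ∀ n {f g : Fin n → ℚ} → (∀ i → f i ≤ℚ g i) → ∑ n f ≤ℚ ∑ n g
∑-mono-≤ zero    f≤g = QP.≤-refl
∑-mono-≤ (suc n) f≤g = QP.+-mono-≤ (f≤g zero) (∑-mono-≤ n (λ i → f≤g (suc i)))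

∑-nonNeg : ∀ n {f : Fin n → ℚ} → (∀ i → 0ℚ ≤ℚ f i) → 0ℚ ≤ℚ ∑ n f
∑-nonNeg n 0≤f = subst (_≤ℚ ∑ n _) (∑-zero n) (∑-mono-≤ n 0≤f)

∑-≤-bound : ∀ n {f : Fin n → ℚ} {b} → (∀ i → f i ≤ℚ b) → ∑ n f ≤ℚ ℕ→ℚ n * b
∑-≤-bound n {b = b} f≤b = subst (∑ n _ ≤ℚ_) (∑-const n b) (∑-mono-≤ n f≤b)

argmax : ∀ k (h : Fin (suc k) → ℚ) → ∃ λ x → ∀ y → h y ≤ℚ h x
argmax zero    h = zero , λ { zero → QP.≤-refl }
argmax (suc k) h with argmax k (λ i → h (suc i))
... | x , x-max with QP.≤-total (h zero) (h (suc x))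
...   | inj₁ h0≤hx = suc x , λ { zero → h0≤hx ; (suc y) → x-max y }
...   | inj₂ hx≤h0 = zero  , λ { zero → QP.≤-refl ; (suc y) → QP.≤-trans (x-max y) hx≤h0 }

∑-sameClass : ∀ {n k} (p : Fin n → Fin k) (X : Fin n → Fin n → ℚ) →
  ∑ k (λ c → ∑ n λ u → ∑ n λ v → X u v * (𝟙 (p u ≟ᶠ c) * 𝟙 (p v ≟ᶠ c)))
    ≡ ∑ n λ u → ∑ n λ v → X u v * 𝟙 (p u ≟ᶠ p v)
∑-sameClass {n} {k} p X = trans (∑-comm k n _) (∑-cong n (λ u → trans (∑-comm k n _) (∑-cong n (λ v →
  trans (*-distribˡ-∑ k (X u v) _)
        (cong (X u v *_) (trans (∑-𝟙-≟ k (p u) (λ c → 𝟙 (p v ≟ᶠ c))) (𝟙-≟-sym (p v) (p u))))))))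

successor : ∀ {T} → Fin T → Fin T → ℚ
successor s t = 𝟙 (toℕ t ℕ.≟ suc (toℕ s))

successor-count : ∀ T → ∑ T (λ s → ∑ T (successor s)) ≡ ℕ→ℚ (T ∸ 1)
successor-count zero    = refl
successor-count (suc T) = begin
  ∑ (suc T) (λ s → ∑ (suc T) (λ t → 𝟙 (toℕ t ℕ.≟ suc (toℕ s))))
    ≡⟨ ∑-cong (suc T) (λ s → trans (cong₂ _+_ (𝟙-no (0 ℕ.≟ suc (toℕ s)) (λ ()))
          (∑-cong T (λ t → 𝟙-cong (suc (toℕ t) ℕ.≟ suc (toℕ s)) (toℕ t ℕ.≟ toℕ s) ℕP.suc-injective (cong suc))))
          (QP.+-identityˡ (∑ T (λ t → 𝟙 (toℕ t ℕ.≟ toℕ s))))) ⟩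
  ∑ (suc T) (λ s → ∑ T (λ t → 𝟙 (toℕ t ℕ.≟ toℕ s)))
    ≡⟨ ∑-comm (suc T) T (λ s t → 𝟙 (toℕ t ℕ.≟ toℕ s)) ⟩
  ∑ T (λ t → ∑ (suc T) (λ s → 𝟙 (toℕ t ℕ.≟ toℕ s)))
    ≡⟨ ∑-cong T (λ t → trans (∑-cong (suc T) (λ s → trans
          (𝟙-cong (toℕ t ℕ.≟ toℕ s) (inject₁ t ≟ᶠ s)
             (λ e → FinP.toℕ-injective (trans (FinP.toℕ-inject₁ t) e))
             (λ e → trans (sym (FinP.toℕ-inject₁ t)) (cong toℕ e)))
          (sym (QP.*-identityʳ _))))
        (∑-𝟙-≟ (suc T) (inject₁ t) (λ _ → 1ℚ))) ⟩
  ∑ T (λ _ → 1ℚ)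
    ≡⟨ trans (∑-const T 1ℚ) (QP.*-identityʳ (ℕ→ℚ T)) ⟩
  ℕ→ℚ T ∎
  where open ≡-Reasoning

trace : ∀ {K} → (Fin K → Fin K → ℚ) → ℚ
trace {K} W = ∑ K λ c → W c c

total : ∀ {K} → (Fin K → Fin K → ℚ) → ℚ
total {K} W = ∑ K λ c → ∑ K λ c′ → W c c′

withinWeight : ∀ {K k} → (Fin K → Fin k) → (Fin K → Fin K → ℚ) → ℚ
withinWeight {K} f W = ∑ K λ c → ∑ K λ c′ → 𝟙 (f c ≟ᶠ f c′) * W c c′

withinWeight-id : ∀ {K} (W : Fin K → Fin K → ℚ) → withinWeight (λ c → c) W ≡ trace W
withinWeight-id {K} W = ∑-cong K (λ c → ∑-𝟙-≟ K c (W c))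

withinWeight-const : ∀ {K} (W : Fin K → Fin K → ℚ) →
  withinWeight (λ (_ : Fin K) → zero {0}) W ≡ total W
withinWeight-const {K} W = ∑-cong K (λ c → ∑-cong K (λ c′ → QP.*-identityˡ (W c c′)))

module _ {K k : ℕ} (f : Fin K → Fin k) where

  withinWeight-+ : ∀ W V → withinWeight f W + withinWeight f V ≡ withinWeight f (λ c c′ → W c c′ + V c c′)
  withinWeight-+ W V = sym (trans (∑-cong K (λ c → trans (∑-cong K (λ c′ →
    QP.*-distribˡ-+ (𝟙 (f c ≟ᶠ f c′)) (W c c′) (V c c′))) (∑-distrib-+ K _ _))) (∑-distrib-+ K _ _))

  withinWeight-* : ∀ x W → x * withinWeight f W ≡ withinWeight f (λ c c′ → x * W c c′)
  withinWeight-* x W = sym (trans (∑-cong K (λ c → trans (∑-cong K (λ c′ →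
    solve 3 (λ p q r → p :* (q :* r) := q :* (p :* r)) refl (𝟙 (f c ≟ᶠ f c′)) x (W c c′)))
    (*-distribˡ-∑ K x _))) (*-distribˡ-∑ K x _))

  withinWeight-∑ : ∀ N (W : Fin N → Fin K → Fin K → ℚ) →
    ∑ N (λ i → withinWeight f (W i)) ≡ withinWeight f (λ c c′ → ∑ N (λ i → W i c c′))
  withinWeight-∑ N W = trans (∑-comm N K _) (∑-cong K (λ c → trans (∑-comm N K _)
    (∑-cong K (λ c′ → *-distribˡ-∑ N (𝟙 (f c ≟ᶠ f c′)) (λ i → W i c c′)))))

  𝟙-≟-withinWeight : (a b : Fin K) → 𝟙 (f a ≟ᶠ f b) ≡ withinWeight f (λ c c′ → 𝟙 (a ≟ᶠ c) * 𝟙 (b ≟ᶠ c′))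
  𝟙-≟-withinWeight a b = sym (begin
    ∑ K (λ c → ∑ K (λ c′ → 𝟙 (f c ≟ᶠ f c′) * (𝟙 (a ≟ᶠ c) * 𝟙 (b ≟ᶠ c′))))
      ≡⟨ ∑-cong K (λ c → trans (∑-cong K (λ c′ →
           solve 3 (λ x y z → x :* (y :* z) := y :* (z :* x)) refl (𝟙 (f c ≟ᶠ f c′)) (𝟙 (a ≟ᶠ c)) (𝟙 (b ≟ᶠ c′))))
           (trans (*-distribˡ-∑ K (𝟙 (a ≟ᶠ c)) (λ c′ → 𝟙 (b ≟ᶠ c′) * 𝟙 (f c ≟ᶠ f c′)))
                  (cong (𝟙 (a ≟ᶠ c) *_) (∑-𝟙-≟ K b (λ c′ → 𝟙 (f c ≟ᶠ f c′)))))) ⟩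
    ∑ K (λ c → 𝟙 (a ≟ᶠ c) * 𝟙 (f c ≟ᶠ f b))
      ≡⟨ ∑-𝟙-≟ K a (λ c → 𝟙 (f c ≟ᶠ f b)) ⟩
    𝟙 (f a ≟ᶠ f b) ∎)
    where open ≡-Reasoning

  ∑³-withinWeight : ∀ N₁ N₂ N₃ (a b : Fin N₁ → Fin N₂ → Fin N₃ → Fin K) (Y : Fin N₁ → Fin N₂ → Fin N₃ → ℚ) →
    ∑ N₁ (λ i → ∑ N₂ (λ j → ∑ N₃ (λ l → Y i j l * 𝟙 (f (a i j l) ≟ᶠ f (b i j l)))))
      ≡ withinWeight f (λ c c′ → ∑ N₁ (λ i → ∑ N₂ (λ j → ∑ N₃ (λ l →
          Y i j l * (𝟙 (a i j l ≟ᶠ c) * 𝟙 (b i j l ≟ᶠ c′))))))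
  ∑³-withinWeight N₁ N₂ N₃ a b Y =
    trans (∑-cong N₁ (λ i → trans (∑-cong N₂ (λ j → trans (∑-cong N₃ (λ l →
        trans (cong (Y i j l *_) (𝟙-≟-withinWeight (a i j l) (b i j l))) (withinWeight-* (Y i j l) _)))
      (withinWeight-∑ N₃ _))) (withinWeight-∑ N₂ _))) (withinWeight-∑ N₁ _)

module _ {K : ℕ} (W : Fin (suc K) → Fin (suc K) → ℚ) where

  minor : Fin K → Fin K → ℚ
  minor c c′ = W (suc c) (suc c′)

  cross : Fin K → ℚ
  cross c = W zero (suc c) + W (suc c) zero

  crossGain : ∀ {k} → (Fin K → Fin k) → Fin k → ℚ
  crossGain g y = ∑ K (λ c → 𝟙 (y ≟ᶠ g c) * cross c)

  total-suc : total W ≡ W zero zero + ∑ K cross + total minor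
  total-suc = begin
    (W zero zero + P) + ∑ K (λ c → W (suc c) zero + ∑ K (minor c))
      ≡⟨ cong (W zero zero + P +_) (∑-distrib-+ K _ _) ⟩
    (W zero zero + P) + (Q + total minor)
      ≡⟨ solve 4 (λ w p q t → (w :+ p) :+ (q :+ t) := w :+ (p :+ q) :+ t) refl (W zero zero) P Q (total minor) ⟩
    W zero zero + (P + Q) + total minor
      ≡⟨ cong (λ z → W zero zero + z + total minor) (sym (∑-distrib-+ K _ _)) ⟩
    W zero zero + ∑ K cross + total minor ∎
    where
    open ≡-Reasoning
    P : ℚ
    P = ∑ K (λ c → W zero (suc c))
    Q : ℚ
    Q = ∑ K (λ c → W (suc c) zero)

  withinWeight-∷ : ∀ {k} (x : Fin k) (g : Fin K → Fin k) →
    withinWeight (x ∷ g) W ≡ W zero zero + crossGain g x + withinWeight g minor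
  withinWeight-∷ x g = begin
    (𝟙 (x ≟ᶠ x) * W zero zero + P) + ∑ K (λ c → 𝟙 (g c ≟ᶠ x) * W (suc c) zero + ∑ K (λ c′ → 𝟙 (g c ≟ᶠ g c′) * minor c c′))
      ≡⟨ cong₂ (λ o z → (o * W zero zero + P) + z) (𝟙-yes (x ≟ᶠ x) refl)
           (trans (∑-distrib-+ K _ _) (cong (_+ withinWeight g minor) (∑-cong K (λ c → cong (_* W (suc c) zero) (𝟙-≟-sym (g c) x))))) ⟩
    (1ℚ * W zero zero + P) + (Q + withinWeight g minor)
      ≡⟨ solve 4 (λ w p q t → (con 1ℚ :* w :+ p) :+ (q :+ t) := w :+ (p :+ q) :+ t) refl (W zero zero) P Q (withinWeight g minor) ⟩
    W zero zero + (P + Q) + withinWeight g minor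
      ≡⟨ cong (λ z → W zero zero + z + withinWeight g minor)
           (sym (trans (∑-cong K (λ c → QP.*-distribˡ-+ (𝟙 (x ≟ᶠ g c)) _ _)) (∑-distrib-+ K _ _))) ⟩
    W zero zero + crossGain g x + withinWeight g minor ∎
    where
    open ≡-Reasoning
    P : ℚ
    P = ∑ K (λ c → 𝟙 (x ≟ᶠ g c) * W zero (suc c))
    Q : ℚ
    Q = ∑ K (λ c → 𝟙 (x ≟ᶠ g c) * W (suc c) zero)

-- Method of conditional expectations: label the classes 1 … K by induction, then give
-- class 0 a label whose cross weight with them is at least the average over labels.
coarsening-bound : ∀ k {K} (W : Fin K → Fin K → ℚ) → ∃ λ (f : Fin K → Fin (suc k)) →
  (ℕ→ℚ (suc k) - 1ℚ) * trace W + total W ≤ℚ ℕ→ℚ (suc k) * withinWeight f W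
coarsening-bound k {zero} W = (λ ()) , QP.≤-reflexive
  (solve 1 (λ κ → (κ :- con 1ℚ) :* con 0ℚ :+ con 0ℚ := κ :* con 0ℚ) refl (ℕ→ℚ (suc k)))
coarsening-bound k {suc K} W with coarsening-bound k (minor W)
... | g , g-bound with argmax k (crossGain W g)
... | x , x-max = x ∷ g , (begin
  (κ - 1ℚ) * (W zero zero + trace (minor W)) + total W
    ≡⟨ cong ((κ - 1ℚ) * (W zero zero + trace (minor W)) +_) (total-suc W) ⟩
  (κ - 1ℚ) * (W zero zero + trace (minor W)) + (W zero zero + ∑ K (cross W) + total (minor W))
    ≡⟨ solve 5 (λ κ w d c t → (κ :- con 1ℚ) :* (w :+ d) :+ (w :+ c :+ t)
                              := κ :* w :+ (((κ :- con 1ℚ) :* d :+ t) :+ c))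
         refl κ (W zero zero) (trace (minor W)) (∑ K (cross W)) (total (minor W)) ⟩
  κ * W zero zero + (((κ - 1ℚ) * trace (minor W) + total (minor W)) + ∑ K (cross W))
    ≤⟨ QP.+-monoʳ-≤ (κ * W zero zero) (QP.+-mono-≤ g-bound cross≤κgain) ⟩
  κ * W zero zero + (κ * withinWeight g (minor W) + κ * crossGain W g x)
    ≡⟨ solve 4 (λ κ w f h → κ :* w :+ (κ :* f :+ κ :* h) := κ :* (w :+ h :+ f))
         refl κ (W zero zero) (withinWeight g (minor W)) (crossGain W g x) ⟩
  κ * (W zero zero + crossGain W g x + withinWeight g (minor W))
    ≡⟨ cong (κ *_) (sym (withinWeight-∷ W x g)) ⟩
  κ * withinWeight (x ∷ g) W ∎)
  where
  open QP.≤-Reasoning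
  κ : ℚ
  κ = ℕ→ℚ (suc k)
  cross≤κgain : ∑ K (cross W) ≤ℚ κ * crossGain W g x
  cross≤κgain = subst (_≤ℚ κ * crossGain W g x) (∑-fibres g (cross W)) (∑-≤-bound (suc k) x-max)

module Modularity {n T : ℕ} (𝒢 : TemporalGraph n T) where

  numerator : ℚ → ∀ {K} → Partition 𝒢 K → ℚ
  numerator ω π = snapshotTerm 𝒢 π + ω * loyalty 𝒢 π

  edge : Fin T → Fin n → Fin n → ℚ
  edge t u v = 𝟙 (toℕ u ℕ.<? toℕ v) * b→ℚ (adj 𝒢 t u v)

  modularityMatrix : Fin T → Fin n → Fin n → ℚ
  modularityMatrix t u v = ℕ→ℚ 2 * edge t u v - (deg 𝒢 u t * deg 𝒢 v t) * recip (ℕ→ℚ 2 * m 𝒢 t)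

  module _ {k : ℕ} (π : Partition 𝒢 k) (t : Fin T) (c : Fin k) where

    χ : Fin n → ℚ
    χ u = 𝟙 (π u t ≟ᶠ c)

    eIn-class : eIn 𝒢 t (part 𝒢 π t c) ≡ ∑ n λ u → ∑ n λ v → edge t u v * (χ u * χ v)
    eIn-class = ∑-cong n (λ u → ∑-cong n (λ v →
      trans (cong₂ (λ x y → 𝟙 (toℕ u ℕ.<? toℕ v) * (x * (y * b→ℚ (adj 𝒢 t u v))))
                   (b→ℚ-does (π u t ≟ᶠ c)) (b→ℚ-does (π v t ≟ᶠ c)))
            (solve 4 (λ l x y a → l :* (x :* (y :* a)) := (l :* a) :* (x :* y))
                   refl (𝟙 (toℕ u ℕ.<? toℕ v)) (χ u) (χ v) (b→ℚ (adj 𝒢 t u v)))))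

    vol²-class : vol 𝒢 t (part 𝒢 π t c) * vol 𝒢 t (part 𝒢 π t c)
      ≡ ∑ n λ u → ∑ n λ v → (deg 𝒢 u t * deg 𝒢 v t) * (χ u * χ v)
    vol²-class = trans (sym (*-distribʳ-∑ n V share)) (∑-cong n (λ u → trans (sym (*-distribˡ-∑ n (share u) share))
      (∑-cong n (λ v →
        trans (cong₂ (λ x y → (x * deg 𝒢 u t) * (y * deg 𝒢 v t)) (b→ℚ-does (π u t ≟ᶠ c)) (b→ℚ-does (π v t ≟ᶠ c)))
              (solve 4 (λ x du y dv → (x :* du) :* (y :* dv) := (du :* dv) :* (x :* y))
                     refl (χ u) (deg 𝒢 u t) (χ v) (deg 𝒢 v t))))))
      where
      V : ℚ
      V = vol 𝒢 t (part 𝒢 π t c)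
      share : Fin n → ℚ
      share u = b→ℚ (part 𝒢 π t c u) * deg 𝒢 u t

    classTerm : ℕ→ℚ 2 * eIn 𝒢 t (part 𝒢 π t c)
                  - (vol 𝒢 t (part 𝒢 π t c) * vol 𝒢 t (part 𝒢 π t c)) ÷' (ℕ→ℚ 2 * m 𝒢 t)
              ≡ ∑ n λ u → ∑ n λ v → modularityMatrix t u v * (χ u * χ v)
    classTerm = begin
      ℕ→ℚ 2 * eIn 𝒢 t (part 𝒢 π t c) - (vol 𝒢 t (part 𝒢 π t c) * vol 𝒢 t (part 𝒢 π t c)) ÷' (ℕ→ℚ 2 * m 𝒢 t)
        ≡⟨ cong₂ (λ e v → ℕ→ℚ 2 * e - v) eIn-class (trans (÷'≡*recip _ (ℕ→ℚ 2 * m 𝒢 t)) (cong (_* r) vol²-class)) ⟩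
      ℕ→ℚ 2 * ∑ n (λ u → ∑ n λ v → edge t u v * (χ u * χ v))
        - ∑ n (λ u → ∑ n λ v → (deg 𝒢 u t * deg 𝒢 v t) * (χ u * χ v)) * r
        ≡⟨ sym (∑∑-linear n (ℕ→ℚ 2) r _ _) ⟩
      ∑ n (λ u → ∑ n λ v → ℕ→ℚ 2 * (edge t u v * (χ u * χ v)) - ((deg 𝒢 u t * deg 𝒢 v t) * (χ u * χ v)) * r)
        ≡⟨ ∑-cong n (λ u → ∑-cong n (λ v →
             solve 5 (λ two e dd x r → two :* (e :* x) :- (dd :* x) :* r := (two :* e :- dd :* r) :* x)
                   refl (ℕ→ℚ 2) (edge t u v) (deg 𝒢 u t * deg 𝒢 v t) (χ u * χ v) r)) ⟩
      ∑ n (λ u → ∑ n λ v → modularityMatrix t u v * (χ u * χ v)) ∎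
      where
      open ≡-Reasoning
      r : ℚ
      r = recip (ℕ→ℚ 2 * m 𝒢 t)

  snapshotTerm-pairs : ∀ {k} (π : Partition 𝒢 k) →
    snapshotTerm 𝒢 π ≡ ∑ T λ t → ∑ n λ u → ∑ n λ v → modularityMatrix t u v * 𝟙 (π u t ≟ᶠ π v t)
  snapshotTerm-pairs {k} π = ∑-cong T (λ t →
    trans (∑-cong k (classTerm π t)) (∑-sameClass (λ u → π u t) (modularityMatrix t)))

  weightMatrix : ∀ {K} → Partition 𝒢 K → ℚ → Fin K → Fin K → ℚ
  weightMatrix π ω c c′ =
      (∑ T λ t → ∑ n λ u → ∑ n λ v → modularityMatrix t u v * (𝟙 (π u t ≟ᶠ c) * 𝟙 (π v t ≟ᶠ c′)))
    + ω * (∑ n λ v → ∑ T λ s → ∑ T λ t → successor s t * (𝟙 (π v s ≟ᶠ c) * 𝟙 (π v t ≟ᶠ c′)))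

  numerator-coarsen : ∀ {K k} (π : Partition 𝒢 K) (f : Fin K → Fin k) ω →
    numerator ω (λ v t → f (π v t)) ≡ withinWeight f (weightMatrix π ω)
  numerator-coarsen π f ω = trans (cong₂ _+_
      (trans (snapshotTerm-pairs (λ v t → f (π v t)))
             (∑³-withinWeight f T n n (λ t u v → π u t) (λ t u v → π v t) modularityMatrix))
      (trans (cong (ω *_) (∑³-withinWeight f n T T (λ v s t → π v s) (λ v s t → π v t) (λ _ → successor)))
             (withinWeight-* f ω _)))
    (withinWeight-+ f _ _)

  -- Pairs u, v with neither u < v nor v < u have u = v, and loops are excluded.
  adj-split : ∀ t u v → b→ℚ (adj 𝒢 t u v) ≡ edge t u v + edge t v u
  adj-split t u v = trans (split (ℕP.<-cmp (toℕ u) (toℕ v)))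
    (trans (QP.*-distribʳ-+ a (𝟙 (toℕ u ℕ.<? toℕ v)) (𝟙 (toℕ v ℕ.<? toℕ u)))
           (cong (λ b → edge t u v + 𝟙 (toℕ v ℕ.<? toℕ u) * b→ℚ b) (adj-sym 𝒢 t u v)))
    where
    a : ℚ
    a = b→ℚ (adj 𝒢 t u v)
    s : ℚ
    s = 𝟙 (toℕ u ℕ.<? toℕ v) + 𝟙 (toℕ v ℕ.<? toℕ u)
    split : Tri (toℕ u ℕ.< toℕ v) (toℕ u ≡ toℕ v) (toℕ v ℕ.< toℕ u) → a ≡ s * a
    split (tri< u<v _ v≮u) = sym (trans (cong (_* a) (cong₂ _+_ (𝟙-yes (toℕ u ℕ.<? toℕ v) u<v)
      (𝟙-no (toℕ v ℕ.<? toℕ u) v≮u))) (QP.*-identityˡ a))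
    split (tri> u≮v _ v<u) = sym (trans (cong (_* a) (cong₂ _+_ (𝟙-no (toℕ u ℕ.<? toℕ v) u≮v)
      (𝟙-yes (toℕ v ℕ.<? toℕ u) v<u))) (QP.*-identityˡ a))
    split (tri≈ _ u≡v _) = trans a≡0 (trans (sym (QP.*-zeroʳ s)) (cong (s *_) (sym a≡0)))
      where
      a≡0 : a ≡ 0ℚ
      a≡0 = cong b→ℚ (trans (cong (adj 𝒢 t u) (sym (FinP.toℕ-injective u≡v))) (adj-irrefl 𝒢 t u))

  m≡∑∑edge : ∀ t → m 𝒢 t ≡ ∑ n (λ u → ∑ n (edge t u))
  m≡∑∑edge t = ∑-cong n (λ u → ∑-cong n (λ v →
    cong (𝟙 (toℕ u ℕ.<? toℕ v) *_) (trans (QP.*-identityˡ _) (QP.*-identityˡ _))))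

  handshake : ∀ t → ∑ n (λ u → deg 𝒢 u t) ≡ ℕ→ℚ 2 * m 𝒢 t
  handshake t = begin
    ∑ n (λ u → ∑ n (λ v → b→ℚ (adj 𝒢 t u v)))
      ≡⟨ ∑-cong n (λ u → trans (∑-cong n (λ v → adj-split t u v)) (∑-distrib-+ n _ _)) ⟩
    ∑ n (λ u → ∑ n (λ v → edge t u v) + ∑ n (λ v → edge t v u))
      ≡⟨ ∑-distrib-+ n _ _ ⟩
    E + ∑ n (λ u → ∑ n (λ v → edge t v u))
      ≡⟨ cong (E +_) (∑-comm n n _) ⟩
    E + E
      ≡⟨ sym (2*x≡x+x E) ⟩
    ℕ→ℚ 2 * E
      ≡⟨ cong (ℕ→ℚ 2 *_) (sym (m≡∑∑edge t)) ⟩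
    ℕ→ℚ 2 * m 𝒢 t ∎
    where
    open ≡-Reasoning
    E : ℚ
    E = ∑ n λ u → ∑ n λ v → edge t u v

  ∑∑-modularityMatrix : ∀ t → 0ℚ < m 𝒢 t → ∑ n (λ u → ∑ n (modularityMatrix t u)) ≡ 0ℚ
  ∑∑-modularityMatrix t 0<m = begin
    ∑ n (λ u → ∑ n (modularityMatrix t u))
      ≡⟨ ∑∑-linear n (ℕ→ℚ 2) r _ _ ⟩
    ℕ→ℚ 2 * ∑ n (λ u → ∑ n (edge t u)) - ∑ n (λ u → ∑ n (λ v → deg 𝒢 u t * deg 𝒢 v t)) * r
      ≡⟨ cong (λ z → ℕ→ℚ 2 * ∑ n (λ u → ∑ n (edge t u)) - z * r)
           (trans (∑-cong n (λ u → *-distribˡ-∑ n (deg 𝒢 u t) _)) (*-distribʳ-∑ n _ _)) ⟩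
    ℕ→ℚ 2 * ∑ n (λ u → ∑ n (edge t u)) - (∑ n (λ u → deg 𝒢 u t) * ∑ n (λ u → deg 𝒢 u t)) * r
      ≡⟨ cong (λ z → ℕ→ℚ 2 * ∑ n (λ u → ∑ n (edge t u)) - (z * z) * r) (handshake t) ⟩
    ℕ→ℚ 2 * ∑ n (λ u → ∑ n (edge t u)) - (x * x) * r
      ≡⟨ cong (λ z → ℕ→ℚ 2 * z - (x * x) * r) (sym (m≡∑∑edge t)) ⟩
    x - (x * x) * r
      ≡⟨ solve 2 (λ x r → x :- (x :* x) :* r := x :* (con 1ℚ :- x :* r)) refl x r ⟩
    x * (1ℚ - x * r)
      ≡⟨ cong (λ z → x * (1ℚ - z)) (*-recip (pos⇒≢0 0<x)) ⟩
    x * (1ℚ - 1ℚ)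
      ≡⟨ solve 1 (λ x → x :* (con 1ℚ :- con 1ℚ) := con 0ℚ) refl x ⟩
    0ℚ ∎
    where
    open ≡-Reasoning
    x : ℚ
    x = ℕ→ℚ 2 * m 𝒢 t
    r : ℚ
    r = recip x
    0<x : 0ℚ < x
    0<x = subst (0ℚ <_) (sym (2*x≡x+x (m 𝒢 t))) (QP.+-mono-< 0<m 0<m)

  numerator-trivial : (∀ t → 0ℚ < m 𝒢 t) → ∀ ω →
    numerator ω (λ (_ : Fin n) (_ : Fin T) → zero {0}) ≡ ℕ→ℚ n * ω * ℕ→ℚ (T ∸ 1)
  numerator-trivial 0<m ω = begin
    snapshotTerm 𝒢 π₀ + ω * loyalty 𝒢 π₀
      ≡⟨ cong₂ (λ a b → a + ω * b) snapshot₀ loyalty₀ ⟩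
    0ℚ + ω * (ℕ→ℚ n * ℕ→ℚ (T ∸ 1))
      ≡⟨ solve 3 (λ w a b → con 0ℚ :+ w :* (a :* b) := a :* w :* b) refl ω (ℕ→ℚ n) (ℕ→ℚ (T ∸ 1)) ⟩
    ℕ→ℚ n * ω * ℕ→ℚ (T ∸ 1) ∎
    where
    open ≡-Reasoning
    π₀ : Partition 𝒢 1
    π₀ _ _ = zero
    snapshot₀ : snapshotTerm 𝒢 π₀ ≡ 0ℚ
    snapshot₀ = trans (snapshotTerm-pairs π₀) (trans (∑-cong T (λ t →
      trans (∑-cong n (λ u → ∑-cong n (λ v → QP.*-identityʳ _))) (∑∑-modularityMatrix t (0<m t)))) (∑-zero T))
    loyalty₀ : loyalty 𝒢 π₀ ≡ ℕ→ℚ n * ℕ→ℚ (T ∸ 1)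
    loyalty₀ = trans (∑-cong n (λ v →
      trans (∑-cong T (λ s → ∑-cong T (λ t → QP.*-identityʳ _))) (successor-count T))) (∑-const n _)

  μ-pos : 1 ≤ T → (∀ t → 0ℚ < m 𝒢 t) → ∀ {ω} → 0ℚ ≤ℚ ω → 0ℚ < μ 𝒢 ω
  μ-pos (ℕ.s≤s _) 0<m {ω} 0≤ω = subst (_< μ 𝒢 ω) (QP.+-identityˡ 0ℚ) (QP.+-mono-≤-< loyal≥0 edges>0)
    where
    loyal≥0 : 0ℚ ≤ℚ (1ℚ ÷' ℕ→ℚ 2) * ω * ℕ→ℚ n * ℕ→ℚ (T ∸ 1)
    loyal≥0 = *-nonNeg (*-nonNeg (*-nonNeg (toWitness {a? = 0ℚ QP.≤? (1ℚ ÷' ℕ→ℚ 2)} tt) 0≤ω)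
                                 (ℕ→ℚ-nonNeg n)) (ℕ→ℚ-nonNeg (T ∸ 1))
    edges>0 : 0ℚ < ∑ T (m 𝒢)
    edges>0 = subst (_< ∑ T (m 𝒢)) (QP.+-identityˡ 0ℚ)
      (QP.+-mono-<-≤ (0<m zero) (∑-nonNeg _ (λ t → QP.<⇒≤ (0<m (suc t)))))

lemma3 : (n T : ℕ) → 1 ≤ T → (𝒢 : TemporalGraph n T)
    → (∀ (t : Fin T) → 0ℚ < m 𝒢 t)
    → (ω : ℚ) → 0ℚ ≤ℚ ω
    → (k : ℕ) → 2 ≤ k
    → (K : ℕ) (π : Partition 𝒢 K)
    → ∃ λ (π′ : Partition 𝒢 k) →
        (1ℚ - (1ℚ ÷' ℕ→ℚ k)) * q 𝒢 ω π
          + (ℕ→ℚ n * ω * ℕ→ℚ (T ∸ 1)) ÷' (ℕ→ℚ 2 * ℕ→ℚ k * μ 𝒢 ω)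
          ≤ℚ q 𝒢 ω π′
lemma3 n T 1≤T 𝒢 0<m ω 0≤ω (suc k) _ K π = (λ v t → f (π v t)) ,
  ÷'-rescale (ℕ→ℚ-pos 1) (ℕ→ℚ-pos k) (μ-pos 1≤T 0<m 0≤ω) (begin
    (κ - 1ℚ) * numerator ω π + ℕ→ℚ n * ω * ℕ→ℚ (T ∸ 1)
      ≡⟨ cong₂ (λ D S → (κ - 1ℚ) * D + S) trace≡numerator (sym total≡trivial) ⟩
    (κ - 1ℚ) * trace W + total W
      ≤⟨ proj₂ (coarsening-bound k W) ⟩
    κ * withinWeight f W
      ≡⟨ cong (κ *_) (sym (numerator-coarsen π f ω)) ⟩
    κ * numerator ω (λ v t → f (π v t)) ∎)
  where
  open Modularity 𝒢
  open QP.≤-Reasoning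
  κ : ℚ
  κ = ℕ→ℚ (suc k)
  W : Fin K → Fin K → ℚ
  W = weightMatrix π ω
  f : Fin K → Fin (suc k)
  f = proj₁ (coarsening-bound k W)
  trace≡numerator : numerator ω π ≡ trace W
  trace≡numerator = trans (numerator-coarsen π (λ c → c) ω) (withinWeight-id W)
  total≡trivial : total W ≡ ℕ→ℚ n * ω * ℕ→ℚ (T ∸ 1)
  total≡trivial = trans (sym (withinWeight-const W))
                        (trans (sym (numerator-coarsen π (λ _ → zero {0}) ω)) (numerator-trivial 0<m ω))
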